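{- Let $\Sigma$ be an alphabet and let $w\in\Sigma^+$ be a non-binary word, i.e. the number of distinct letters occurring in $w$ is not $2$. Then every element of $\mathtt{BR}(w)$ is rich if and only if either $w=a_1a_2a_3\cdots a_k$ where $a_1,\dots,a_k\in\Sigma$ are pairwise distinct letters, or $w=a^{|w|}$ for a single letter $a\in\Sigma$.
   Context: For $w\in\Sigma^+$, the block reversal of $w$ is the set $\mathtt{BR}(w)=\{B_tB_{t-1}\cdots B_1 : w=B_1B_2\cdots B_t,\ t\ge 1,\ B_i\in\Sigma^+\}$. A word is a palindrome if it equals its reversal. Every word $w$ has at most $|w|$ distinct non-empty palindromic factors; $w$ is called rich if it has exactly $|w|$ distinct non-empty palindromic factors. -}

module Defs where

open import Data.List using (List; []; _∷_; _++_; length; reverse; concat)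
open import Data.List.Relation.Unary.All using (All)
open import Data.List.Relation.Unary.Unique.Propositional using (Unique)
open import Data.List.Membership.Propositional using (_∈_)
open import Data.Product using (Σ; ∃; _×_; _,_)
open import Data.Nat using (ℕ)
open import Relation.Binary.PropositionalEquality using (_≡_; _≢_)
open import Relation.Nullary using (¬_)
open import Function.Bundles using (_⇔_)

NonEmpty : ∀ {A : Set} → List A → Set
NonEmpty w = w ≢ []

Factor : ∀ {A : Set} → List A → List A → Set
Factor {A} u w = Σ (List A) λ p → Σ (List A) λ s → p ++ u ++ s ≡ w

Palindrome : ∀ {A : Set} → List A → Set
Palindrome u = reverse u ≡ u

PalFactor : ∀ {A : Set} → List A → List A → Set
PalFactor w u = NonEmpty u × Palindrome u × Factor u w

NumPalFactors : ∀ {A : Set} → List A → ℕ → Set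
NumPalFactors {A} w n =
  Σ (List (List A)) λ L → Unique L × (∀ u → u ∈ L ⇔ PalFactor w u) × length L ≡ n

Rich : ∀ {A : Set} → List A → Set
Rich w = NumPalFactors w (length w)

-- v ∈ BR(w): v = B_t ⋯ B_1 for a factorization w = B_1 ⋯ B_t, t ≥ 1, B_i non-empty.
InBR : ∀ {A : Set} → List A → List A → Set
InBR {A} w v = Σ (List (List A)) λ Bs →
  NonEmpty Bs × All NonEmpty Bs × concat Bs ≡ w × v ≡ concat (reverse Bs)

NumLetters : ∀ {A : Set} → List A → ℕ → Set
NumLetters {A} w n =
  Σ (List A) λ L → Unique L × (∀ a → a ∈ L ⇔ a ∈ w) × length L ≡ n

-- Every block reversal of w is a permutation of w. This gives the backward direction: a
-- permutation of a word with pairwise distinct letters, or of aⁿ, is again such a word, and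
-- such words are rich (their palindromic factors are the letters, resp. a¹, …, aⁿ).
--
-- For the forward direction, appending a letter to a word creates at most one new palindromic
-- factor, so a word is rich only if each of its prefixes ends in a new palindrome. If w has a
-- repeated letter and at least three distinct letters, a case analysis yields a block reversal
-- R cᵏ⁺¹ g M h c s in which c occurs neither in R nor in g M, g ≠ h and h ≠ c. A palindrome
-- ending at the displayed second c would have to begin with c h, which does not occur earlier,
-- so the prefix ending there gains no palindrome and that block reversal is not rich.

module Submission where

open import Defs
open import Data.Empty using (⊥-elim)
open import Data.List
  using (List; []; _∷_; _++_; [_]; length; reverse; concat; replicate; filter; map; applyUpTo
        ; _∷ʳ_; _∷ʳ′_; initLast)
open import Data.List.Properties
open import Data.List.Membership.Propositional using (_∈_; _∉_; find)
open import Data.List.Membership.Propositional.Properties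
  using (∈-∃++; ∈-++⁺ʳ; ∈-++⁺ˡ; ∈-++⁻; ∈-filter⁻; ∈-map⁺; ∈-map⁻; ∈-applyUpTo⁺; ∈-applyUpTo⁻)
open import Data.List.Relation.Binary.Permutation.Propositional using (_↭_; ↭-refl; ↭-sym; ↭-trans; ↭⇒↭ₛ)
open import Data.List.Relation.Binary.Permutation.Propositional.Properties using (++-comm; ++⁺ˡ; All-resp-↭)
open import Data.List.Relation.Binary.Permutation.Setoid.Properties using (Unique-resp-↭)
open import Data.List.Relation.Unary.All as All using (All; []; _∷_; all?)
open import Data.List.Relation.Unary.All.Properties using (++⁻ˡ; ++⁻ʳ; replicate⁺; ¬All⇒Any¬; ¬Any⇒All¬)
open import Data.List.Relation.Unary.AllPairs using ([]; _∷_; tail)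
open import Data.List.Relation.Unary.Any using (here; there)
open import Data.List.Relation.Unary.Unique.Propositional using (Unique)
open import Data.List.Relation.Unary.Unique.Propositional.Properties using (filter⁺; map⁺; applyUpTo⁺₁)
open import Data.Nat using (ℕ; zero; suc; _+_; _∸_; _≤_; _<_; z≤n; s≤s)
open import Data.Nat.Properties
  using (≤-trans; ≤-reflexive; ≤-total; 1+n≰n; <⇒≢; +-suc; +-identityʳ; +-comm; +-mono-≤; m+[n∸m]≡n
        ; module ≤-Reasoning)
open import Data.Product using (Σ; ∃; _×_; _,_)
open import Data.Sum using (_⊎_; inj₁; inj₂; swap)
open import Function.Base using (_∘_)
open import Function.Bundles using (_⇔_; mk⇔; Equivalence)
open import Relation.Binary.Definitions using (DecidableEquality)
open import Relation.Binary.PropositionalEquality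
  using (_≡_; _≢_; refl; sym; trans; cong; cong₂; subst; subst₂; module ≡-Reasoning)
open import Relation.Binary.PropositionalEquality.Properties using (setoid)
open import Relation.Nullary using (¬_; Dec; yes; no)
open import Relation.Nullary.Decidable using (_⊎-dec_)
open import Relation.Unary using (Pred; Decidable)
open import Relation.Unary.Properties using (∁?)

module _ {B : Set} where

  length-filter+filter-∁ : ∀ {ℓ} {P : Pred B ℓ} (P? : Decidable P) xs →
                           length (filter P? xs) + length (filter (∁? P?) xs) ≡ length xs
  length-filter+filter-∁ P? []       = refl
  length-filter+filter-∁ P? (x ∷ xs) with P? x
  ... | yes _ = cong suc (length-filter+filter-∁ P? xs)
  ... | no  _ = trans (+-suc _ _) (cong suc (length-filter+filter-∁ P? xs))

  unique-constant-length≤1 : ∀ {xs : List B} → Unique xs →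
                             (∀ {x y} → x ∈ xs → y ∈ xs → x ≡ y) → length xs ≤ 1
  unique-constant-length≤1 {[]}        _               _     = z≤n
  unique-constant-length≤1 {_ ∷ []}    _               _     = s≤s z≤n
  unique-constant-length≤1 {_ ∷ _ ∷ _} ((x≢y ∷ _) ∷ _) const =
    ⊥-elim (x≢y (const (here refl) (there (here refl))))

module _ {A : Set} where

  ∷ʳ≢[] : ∀ (xs : List A) {x} → xs ∷ʳ x ≢ []
  ∷ʳ≢[] []      ()
  ∷ʳ≢[] (_ ∷ _) ()

  ∈-∷⁻ : ∀ {x y : A} {l} → x ∈ y ∷ l → x ≢ y → x ∈ l
  ∈-∷⁻ (here x≡y) x≢y = ⊥-elim (x≢y x≡y)
  ∈-∷⁻ (there x∈l) _  = x∈l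

  ∉-∷ʳ : ∀ {x y : A} {xs} → x ∉ xs → y ≢ x → x ∉ xs ∷ʳ y
  ∉-∷ʳ {xs = xs} x∉xs y≢x x∈ with ∈-++⁻ xs x∈
  ... | inj₁ x∈xs       = x∉xs x∈xs
  ... | inj₂ (here x≡y) = y≢x (sym x≡y)

  Unique-drop : ∀ (p : List A) {xs} → Unique (p ++ xs) → Unique xs
  Unique-drop []      uniq       = uniq
  Unique-drop (_ ∷ p) (_ ∷ uniq) = Unique-drop p uniq

  Unique-∉-prefix : ∀ (p : List A) {x xs} → Unique (p ++ x ∷ xs) → x ∉ p
  Unique-∉-prefix (_ ∷ p) (_    ∷ uniq) (there x∈p) = Unique-∉-prefix p uniq x∈p
  Unique-∉-prefix (_ ∷ p) (y≢ ∷ _)     (here refl) = All.lookup y≢ (∈-++⁺ʳ p (here refl)) refl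

  Unique-head-∉ : ∀ {x : A} {xs} → Unique (x ∷ xs) → x ∉ xs
  Unique-head-∉ (x≢ ∷ _) x∈xs = All.lookup x≢ x∈xs refl

  All-≡⇒≡replicate : ∀ {a : A} {xs} → All (_≡ a) xs → xs ≡ replicate (length xs) a
  All-≡⇒≡replicate []           = refl
  All-≡⇒≡replicate (refl ∷ all) = cong (_ ∷_) (All-≡⇒≡replicate all)

  replicate-++ : ∀ m n (a : A) → replicate m a ++ replicate n a ≡ replicate (m + n) a
  replicate-++ zero    n a = refl
  replicate-++ (suc m) n a = cong (a ∷_) (replicate-++ m n a)

  replicate-++-∷ : ∀ m (a : A) xs → replicate m a ++ a ∷ xs ≡ a ∷ replicate m a ++ xs
  replicate-++-∷ zero    a xs = refl
  replicate-++-∷ (suc m) a xs = cong (a ∷_) (replicate-++-∷ m a xs)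

  reverse-replicate : ∀ n (a : A) → reverse (replicate n a) ≡ replicate n a
  reverse-replicate zero    a = refl
  reverse-replicate (suc n) a = begin
    reverse (a ∷ replicate n a)    ≡⟨ unfold-reverse a (replicate n a) ⟩
    reverse (replicate n a) ∷ʳ a   ≡⟨ cong (_∷ʳ a) (reverse-replicate n a) ⟩
    replicate n a ++ a ∷ []        ≡⟨ replicate-++-∷ n a [] ⟩
    a ∷ replicate n a ++ []        ≡⟨ cong (a ∷_) (++-identityʳ (replicate n a)) ⟩
    a ∷ replicate n a              ∎
    where open ≡-Reasoning

  -- Palindromic factors

  ∈⇒Factor : ∀ {x : A} {xs} → x ∈ xs → Factor [ x ] xs
  ∈⇒Factor x∈xs with ys , zs , eq ← ∈-∃++ x∈xs = ys , zs , sym eq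

  ¬Factor-∉ : ∀ {c : A} {xs G} → c ∉ G → ¬ Factor (c ∷ xs) G
  ¬Factor-∉ c∉G (p , s , refl) = c∉G (∈-++⁺ʳ p (here refl))

  Factor-skip-∉ : ∀ {c : A} {xs} R {T} → c ∉ R → Factor (c ∷ xs) (R ++ T) → Factor (c ∷ xs) T
  Factor-skip-∉ []      c∉R fac              = fac
  Factor-skip-∉ (_ ∷ R) c∉R ([]    , s , eq) = ⊥-elim (c∉R (here (∷-injectiveˡ eq)))
  Factor-skip-∉ (_ ∷ R) c∉R (_ ∷ p , s , eq) = Factor-skip-∉ R (c∉R ∘ there) (p , s , ∷-injectiveʳ eq)

  factor-∷ʳ⁻ : ∀ {u v : List A} {a} p t → t ≢ [] → p ++ u ++ t ≡ v ∷ʳ a → Factor u v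
  factor-∷ʳ⁻ {u} {v} {a} p t t≢[] eq with initLast t
  ... | []      = ⊥-elim (t≢[] refl)
  ... | s ∷ʳ′ b = p , s , ∷ʳ-injectiveˡ (p ++ u ++ s) v (begin
    (p ++ u ++ s) ∷ʳ b  ≡⟨ ++-assoc p (u ++ s) [ b ] ⟩
    p ++ (u ++ s) ∷ʳ b  ≡⟨ cong (p ++_) (++-assoc u s [ b ]) ⟩
    p ++ u ++ s ∷ʳ b    ≡⟨ eq ⟩
    v ∷ʳ a              ∎)
    where open ≡-Reasoning

  new-factor-suffix : ∀ {u v : List A} {a} → Factor u (v ∷ʳ a) → ¬ Factor u v →
                      ∃ λ P → P ++ u ≡ v ∷ʳ a
  new-factor-suffix {u} (p , s , eq) old with initLast s
  ... | []       = p , trans (cong (p ++_) (sym (++-identityʳ u))) eq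
  ... | s′ ∷ʳ′ b = ⊥-elim (old (factor-∷ʳ⁻ p (s′ ∷ʳ b) (∷ʳ≢[] s′) eq))

  shorter-suffix : ∀ P Q {u w : List A} → P ++ u ≡ Q ++ w → length u ≤ length w →
                   ∃ λ t → w ≡ t ++ u
  shorter-suffix P       []      eq _  = P , sym eq
  shorter-suffix []      (x ∷ Q) {u} {w} refl le =
    ⊥-elim (1+n≰n (≤-trans (s≤s (length-++-≤ʳ w {Q})) le))
  shorter-suffix (_ ∷ P) (_ ∷ Q) eq le = shorter-suffix P Q (∷-injectiveʳ eq) le

  palindrome-∷ʳ-∷ʳ : ∀ {xs : List A} {d c} → d ≢ c → Palindrome ((xs ∷ʳ d) ∷ʳ c) →
                     ∃ λ ys → xs ∷ʳ d ≡ c ∷ d ∷ ys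
  palindrome-∷ʳ-∷ʳ {[]}     d≢c pal = ⊥-elim (d≢c (sym (∷-injectiveˡ pal)))
  palindrome-∷ʳ-∷ʳ {x ∷ xs} {d} {c} d≢c pal =
    reverse xs , sym (∷ʳ-injectiveˡ (c ∷ d ∷ reverse xs) ((x ∷ xs) ∷ʳ d) (begin
      (c ∷ d ∷ reverse xs) ∷ʳ x      ≡⟨ cong (λ r → c ∷ d ∷ r) (sym (unfold-reverse x xs)) ⟩
      c ∷ d ∷ reverse (x ∷ xs)       ≡⟨ cong (c ∷_) (sym (reverse-++ (x ∷ xs) [ d ])) ⟩
      c ∷ reverse ((x ∷ xs) ∷ʳ d)    ≡⟨ sym (reverse-++ ((x ∷ xs) ∷ʳ d) [ c ]) ⟩
      reverse ((x ∷ xs) ∷ʳ d ∷ʳ c)   ≡⟨ pal ⟩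
      (x ∷ xs) ∷ʳ d ∷ʳ c             ∎))
    where open ≡-Reasoning

  -- The shorter of two palindromic suffixes is also a prefix of the longer one, hence
  -- occurs one letter earlier unless they coincide.
  new-palFactor-unique≤ : ∀ {v : List A} {a u₁ u₂} →
    PalFactor (v ∷ʳ a) u₁ → PalFactor (v ∷ʳ a) u₂ → ¬ Factor u₁ v → ¬ Factor u₂ v →
    length u₁ ≤ length u₂ → u₁ ≡ u₂
  new-palFactor-unique≤ {v} {a} {u₁} {u₂} (_ , pal₁ , f₁) (_ , pal₂ , f₂) new₁ new₂ le
    with new-factor-suffix f₁ new₁ | new-factor-suffix f₂ new₂
  ... | P₁ , suf₁ | P₂ , suf₂ with shorter-suffix P₁ P₂ (trans suf₁ (sym suf₂)) le
  ... | []    , refl = refl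
  ... | x ∷ t , refl = ⊥-elim (new₁ (factor-∷ʳ⁻ P₂ (reverse (x ∷ t)) rev≢[] (begin
    P₂ ++ u₁ ++ reverse (x ∷ t)  ≡⟨ cong (P₂ ++_) u₁-prefix ⟩
    P₂ ++ (x ∷ t) ++ u₁          ≡⟨ suf₂ ⟩
    v ∷ʳ a                       ∎)))
    where
    open ≡-Reasoning
    rev≢[] : reverse (x ∷ t) ≢ []
    rev≢[] eq = ∷ʳ≢[] (reverse t) (trans (sym (unfold-reverse x t)) eq)
    u₁-prefix : u₁ ++ reverse (x ∷ t) ≡ (x ∷ t) ++ u₁
    u₁-prefix = begin
      u₁ ++ reverse (x ∷ t)          ≡⟨ cong (_++ reverse (x ∷ t)) (sym pal₁) ⟩
      reverse u₁ ++ reverse (x ∷ t)  ≡⟨ sym (reverse-++ (x ∷ t) u₁) ⟩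
      reverse ((x ∷ t) ++ u₁)        ≡⟨ pal₂ ⟩
      (x ∷ t) ++ u₁                  ∎

  new-palFactor-unique : ∀ {v : List A} {a u₁ u₂} →
    PalFactor (v ∷ʳ a) u₁ → PalFactor (v ∷ʳ a) u₂ → ¬ Factor u₁ v → ¬ Factor u₂ v → u₁ ≡ u₂
  new-palFactor-unique {u₁ = u₁} {u₂} p₁ p₂ new₁ new₂ with ≤-total (length u₁) (length u₂)
  ... | inj₁ le = new-palFactor-unique≤ p₁ p₂ new₁ new₂ le
  ... | inj₂ le = sym (new-palFactor-unique≤ p₂ p₁ new₂ new₁ le)

  AtMostPalFactors : List A → ℕ → Set
  AtMostPalFactors v n = ∀ L → Unique L → (∀ {u} → u ∈ L → PalFactor v u) → length L ≤ n

  atMostPalFactors-[] : AtMostPalFactors [] 0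
  atMostPalFactors-[] []      _ _   = z≤n
  atMostPalFactors-[] (u ∷ L) _ pal with pal (here refl)
  ... | u≢[] , _ , p , s , eq = ⊥-elim (u≢[] (++-conicalˡ u s (++-conicalʳ p (u ++ s) eq)))

  atMostPalFactors-∷ʳ-old : ∀ {v a n} → (∀ {u} → PalFactor (v ∷ʳ a) u → Factor u v) →
                            AtMostPalFactors v n → AtMostPalFactors (v ∷ʳ a) n
  atMostPalFactors-∷ʳ-old old bound L uniq pal =
    bound L uniq λ u∈L → let (u≢[] , palu , _) = pal u∈L in u≢[] , palu , old (pal u∈L)

  atMostPalFactors⇒¬Rich : ∀ {v n} → AtMostPalFactors v n → n < length v → ¬ Rich v
  atMostPalFactors⇒¬Rich bound n<|v| (L , uniq , L⇔pal , |L|≡|v|) =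
    1+n≰n (≤-trans n<|v| (subst (_≤ _) |L|≡|v| (bound L uniq (Equivalence.to (L⇔pal _)))))

  Unique⇒palFactor-singleton : ∀ {v u : List A} → Unique v → PalFactor v u → ∃ λ x → u ≡ [ x ]
  Unique⇒palFactor-singleton {u = []}     _    (u≢[] , _) = ⊥-elim (u≢[] refl)
  Unique⇒palFactor-singleton {u = x ∷ u} uniq (_ , pal , p , s , refl) with initLast u
  ... | []      = x , refl
  ... | M ∷ʳ′ y = ⊥-elim (Unique-head-∉ (Unique-drop p uniq) (∈-++⁺ˡ (∈-++⁺ʳ M (here x≡y))))
    where
    x≡y : x ≡ y
    x≡y = sym (∷-injectiveˡ (trans (sym (reverse-++ (x ∷ M) [ y ])) pal))

  Unique⇒Rich : ∀ {v : List A} → Unique v → Rich v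
  Unique⇒Rich {v} uniq = map [_] v , map⁺ ∷-injectiveˡ uniq , (λ u → mk⇔ (to u) (from u)) , length-map [_] v
    where
    to : ∀ u → u ∈ map [_] v → PalFactor v u
    to u u∈ with x , x∈v , refl ← ∈-map⁻ [_] u∈ = (λ ()) , refl , ∈⇒Factor x∈v
    from : ∀ u → PalFactor v u → u ∈ map [_] v
    from u palu@(_ , _ , p , s , eq) with x , refl ← Unique⇒palFactor-singleton uniq palu =
      ∈-map⁺ [_] (subst (x ∈_) eq (∈-++⁺ʳ p (here refl)))

  Rich-replicate : ∀ n (a : A) → Rich (replicate n a)
  Rich-replicate n a =
    applyUpTo run n , applyUpTo⁺₁ run n distinct , (λ u → mk⇔ to (from u)) ,
    trans (length-applyUpTo run n) (sym (length-replicate n))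
    where
    run : ℕ → List A
    run i = replicate (suc i) a
    distinct : ∀ {i j} → i < j → j < n → run i ≢ run j
    distinct {i} {j} i<j _ eq = <⇒≢ (s≤s i<j)
      (trans (sym (length-replicate (suc i))) (trans (cong length eq) (length-replicate (suc j))))
    to : ∀ {u} → u ∈ applyUpTo run n → PalFactor (replicate n a) u
    to u∈ with i , i<n , refl ← ∈-applyUpTo⁻ run u∈ =
      (λ ()) , reverse-replicate (suc i) a , [] , replicate (n ∸ suc i) a ,
      trans (replicate-++ (suc i) (n ∸ suc i) a) (cong (λ m → replicate m a) (m+[n∸m]≡n i<n))
    from : ∀ u → PalFactor (replicate n a) u → u ∈ applyUpTo run n
    from []      (u≢[] , _) = ⊥-elim (u≢[] refl)
    from (x ∷ u) (_ , _ , p , s , eq) = subst (_∈ applyUpTo run n) (sym u≡run) (∈-applyUpTo⁺ run |u|<n)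
      where
      u≡run : x ∷ u ≡ run (length u)
      u≡run = All-≡⇒≡replicate (++⁻ˡ (x ∷ u) (++⁻ʳ p (subst (All (_≡ a)) (sym eq) (replicate⁺ n refl))))
      |u|<n : length u < n
      |u|<n = begin-strict
        length u                     <⟨ s≤s (length-++-≤ˡ u) ⟩
        length (x ∷ u ++ s)          ≤⟨ length-++-≤ʳ (x ∷ u ++ s) {p} ⟩
        length (p ++ x ∷ u ++ s)     ≡⟨ cong length eq ⟩
        length (replicate n a)       ≡⟨ length-replicate n ⟩
        n                            ∎
        where open ≤-Reasoning

  -- Block reversals

  concat-reverse-∷ : ∀ (B : List A) Bs → concat (reverse (B ∷ Bs)) ≡ concat (reverse Bs) ++ B
  concat-reverse-∷ B Bs = begin
    concat (reverse (B ∷ Bs))         ≡⟨ cong concat (unfold-reverse B Bs) ⟩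
    concat (reverse Bs ++ [ B ])      ≡⟨ sym (concat-++ (reverse Bs) [ B ]) ⟩
    concat (reverse Bs) ++ B ++ []    ≡⟨ cong (concat (reverse Bs) ++_) (++-identityʳ B) ⟩
    concat (reverse Bs) ++ B          ∎
    where open ≡-Reasoning

  concat-reverse-↭ : ∀ (Bs : List (List A)) → concat (reverse Bs) ↭ concat Bs
  concat-reverse-↭ []       = ↭-refl
  concat-reverse-↭ (B ∷ Bs) = subst (_↭ B ++ concat Bs) (sym (concat-reverse-∷ B Bs))
    (↭-trans (++-comm (concat (reverse Bs)) B) (++⁺ˡ B (concat-reverse-↭ Bs)))

  InBR⇒↭ : ∀ {w v : List A} → InBR w v → v ↭ w
  InBR⇒↭ (Bs , _ , _ , refl , refl) = concat-reverse-↭ Bs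

  dropEmpty : List (List A) → List (List A)
  dropEmpty []               = []
  dropEmpty ([]    ∷ Bs)     = dropEmpty Bs
  dropEmpty (B@(_ ∷ _) ∷ Bs) = B ∷ dropEmpty Bs

  concat-dropEmpty : ∀ Bs → concat (dropEmpty Bs) ≡ concat Bs
  concat-dropEmpty []             = refl
  concat-dropEmpty ([]    ∷ Bs)   = concat-dropEmpty Bs
  concat-dropEmpty ((x ∷ B) ∷ Bs) = cong ((x ∷ B) ++_) (concat-dropEmpty Bs)

  concat-reverse-dropEmpty : ∀ Bs → concat (reverse (dropEmpty Bs)) ≡ concat (reverse Bs)
  concat-reverse-dropEmpty []             = refl
  concat-reverse-dropEmpty ([]    ∷ Bs)   = begin
    concat (reverse (dropEmpty Bs))       ≡⟨ concat-reverse-dropEmpty Bs ⟩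
    concat (reverse Bs)                   ≡⟨ sym (++-identityʳ _) ⟩
    concat (reverse Bs) ++ []             ≡⟨ sym (concat-reverse-∷ [] Bs) ⟩
    concat (reverse ([] ∷ Bs))            ∎
    where open ≡-Reasoning
  concat-reverse-dropEmpty ((x ∷ B) ∷ Bs) = begin
    concat (reverse ((x ∷ B) ∷ dropEmpty Bs))  ≡⟨ concat-reverse-∷ (x ∷ B) (dropEmpty Bs) ⟩
    concat (reverse (dropEmpty Bs)) ++ x ∷ B   ≡⟨ cong (_++ x ∷ B) (concat-reverse-dropEmpty Bs) ⟩
    concat (reverse Bs) ++ x ∷ B               ≡⟨ sym (concat-reverse-∷ (x ∷ B) Bs) ⟩
    concat (reverse ((x ∷ B) ∷ Bs))            ∎
    where open ≡-Reasoning

  All-NonEmpty-dropEmpty : ∀ Bs → All NonEmpty (dropEmpty Bs)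
  All-NonEmpty-dropEmpty []             = []
  All-NonEmpty-dropEmpty ([]    ∷ Bs)   = All-NonEmpty-dropEmpty Bs
  All-NonEmpty-dropEmpty ((x ∷ B) ∷ Bs) = (λ ()) ∷ All-NonEmpty-dropEmpty Bs

  InBR-concat : ∀ Bs → concat Bs ≢ [] → InBR (concat Bs) (concat (reverse Bs))
  InBR-concat Bs ne =
    dropEmpty Bs , (λ eq → ne (trans (sym (concat-dropEmpty Bs)) (cong concat eq))) ,
    All-NonEmpty-dropEmpty Bs , concat-dropEmpty Bs , sym (concat-reverse-dropEmpty Bs)

  backward : ∀ {w : List A} → Unique w ⊎ ∃ (λ a → w ≡ replicate (length w) a) →
             ∀ v → InBR w v → Rich v
  backward (inj₁ uniq) v br =
    Unique⇒Rich (Unique-resp-↭ (setoid A) (↭⇒↭ₛ (↭-sym (InBR⇒↭ br))) uniq)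
  backward {w} (inj₂ (a , w≡aⁿ)) v br = subst Rich (sym (All-≡⇒≡replicate all-a)) (Rich-replicate _ a)
    where
    all-a : All (_≡ a) v
    all-a = All-resp-↭ (↭-sym (InBR⇒↭ br)) (subst (All (_≡ a)) (sym w≡aⁿ) (replicate⁺ (length w) refl))

  -- Distinct letters

  ThreeDistinct : List A → Set
  ThreeDistinct l = ∃ λ x → ∃ λ y → ∃ λ z → x ∈ l × y ∈ l × z ∈ l × x ≢ y × y ≢ z × x ≢ z

  OverLetters : A → A → List A → Set
  OverLetters b c = All (λ s → s ≡ b ⊎ s ≡ c)

  OverLetters⇒¬ThreeDistinct : ∀ {b c l} → OverLetters b c l → ¬ ThreeDistinct l
  OverLetters⇒¬ThreeDistinct over (x , y , z , x∈ , y∈ , z∈ , x≢y , y≢z , x≢z)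
    with All.lookup over x∈ | All.lookup over y∈ | All.lookup over z∈
  ... | inj₁ refl | inj₁ refl | _         = x≢y refl
  ... | inj₂ refl | inj₂ refl | _         = x≢y refl
  ... | inj₁ refl | _         | inj₁ refl = x≢z refl
  ... | inj₂ refl | _         | inj₂ refl = x≢z refl
  ... | _         | inj₁ refl | inj₁ refl = y≢z refl
  ... | _         | inj₂ refl | inj₂ refl = y≢z refl

  ThreeDistinct⇒3≤length : ∀ {l} → ThreeDistinct l → 3 ≤ length l
  ThreeDistinct⇒3≤length {[]}            (_ , _ , _ , () , _)
  ThreeDistinct⇒3≤length {a ∷ []}        three =
    ⊥-elim (OverLetters⇒¬ThreeDistinct {b = a} {c = a} (inj₁ refl ∷ []) three)
  ThreeDistinct⇒3≤length {a ∷ b ∷ []}    three =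
    ⊥-elim (OverLetters⇒¬ThreeDistinct (inj₁ refl ∷ inj₂ refl ∷ []) three)
  ThreeDistinct⇒3≤length {_ ∷ _ ∷ _ ∷ _} _ = s≤s (s≤s (s≤s z≤n))

  ThreeDistinct-∷⁻ : ∀ {t l} → t ∈ l → ThreeDistinct (t ∷ l) → ThreeDistinct l
  ThreeDistinct-∷⁻ {t} {l} t∈l (x , y , z , x∈ , y∈ , z∈ , distinct) =
    x , y , z , absorb x∈ , absorb y∈ , absorb z∈ , distinct
    where
    absorb : ∀ {a} → a ∈ t ∷ l → a ∈ l
    absorb (here refl) = t∈l
    absorb (there a∈l) = a∈l

  ThreeDistinct-∷⇒two : ∀ {t l} → ThreeDistinct (t ∷ l) → ∃ λ b → ∃ λ c → b ≢ c × b ∈ l × c ∈ l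
  ThreeDistinct-∷⇒two (_ , _ , _ , here refl , here refl , _         , x≢y , _)   = ⊥-elim (x≢y refl)
  ThreeDistinct-∷⇒two (_ , _ , _ , here refl , _         , here refl , _ , _ , x≢z) = ⊥-elim (x≢z refl)
  ThreeDistinct-∷⇒two (_ , _ , _ , _         , here refl , here refl , _ , y≢z , _) = ⊥-elim (y≢z refl)
  ThreeDistinct-∷⇒two (x , y , _ , there x∈ , there y∈  , _         , x≢y , _)   = x , y , x≢y , x∈ , y∈
  ThreeDistinct-∷⇒two (_ , y , z , here _    , there y∈  , there z∈  , _ , y≢z , _) = y , z , y≢z , y∈ , z∈
  ThreeDistinct-∷⇒two (x , _ , z , there x∈ , here _    , there z∈  , _ , _ , x≢z) = x , z , x≢z , x∈ , z∈

  OverLetters⇒NumLetters2 : ∀ {b c : A} {l} → b ≢ c → b ∈ l → c ∈ l → OverLetters b c l → NumLetters l 2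
  OverLetters⇒NumLetters2 {b} {c} {l} b≢c b∈l c∈l over =
    b ∷ c ∷ [] , (b≢c ∷ []) ∷ [] ∷ [] , (λ x → mk⇔ to from) , refl
    where
    to : ∀ {x} → x ∈ b ∷ c ∷ [] → x ∈ l
    to (here refl)         = b∈l
    to (there (here refl)) = c∈l
    from : ∀ {x} → x ∈ l → x ∈ b ∷ c ∷ []
    from x∈l with All.lookup over x∈l
    ... | inj₁ refl = here refl
    ... | inj₂ refl = there (here refl)

  OverLetters-∉ : ∀ {d c : A} {l} → OverLetters d c l → c ∉ l → All (_≡ d) l
  OverLetters-∉ []              _   = []
  OverLetters-∉ (inj₁ x≡d ∷ over) c∉l = x≡d ∷ OverLetters-∉ over (c∉l ∘ there)
  OverLetters-∉ (inj₂ refl ∷ _)   c∉l = ⊥-elim (c∉l (here refl))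

  split-first : ∀ {d c : A} {l} → OverLetters d c l → c ∈ l →
                ∃ λ m → ∃ λ r → l ≡ replicate m d ++ c ∷ r
  split-first (inj₂ refl ∷ _)    _           = 0 , _ , refl
  split-first (inj₁ refl ∷ _)    (here refl) = 0 , _ , refl
  split-first (inj₁ refl ∷ over) (there c∈)  with m , r , refl ← split-first over c∈ = suc m , r , refl

module _ {A : Set} (_≟_ : DecidableEquality A) where

  open import Data.List.Membership.DecPropositional _≟_ using (_∈?_)
  open import Data.List.Relation.Unary.Unique.DecPropositional _≟_ using (unique?)

  prefix? : ∀ (u w : List A) → Dec (∃ λ s → u ++ s ≡ w)
  prefix? []      w       = yes (w , refl)
  prefix? (x ∷ u) []      = no λ ()
  prefix? (x ∷ u) (y ∷ w) with x ≟ y | prefix? u w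
  ... | yes refl | yes (s , eq) = yes (s , cong (x ∷_) eq)
  ... | yes refl | no ¬pre      = no λ (s , eq) → ¬pre (s , ∷-injectiveʳ eq)
  ... | no x≢y   | _            = no λ (s , eq) → x≢y (∷-injectiveˡ eq)

  factor? : ∀ (u w : List A) → Dec (Factor u w)
  factor? []      []      = yes ([] , [] , refl)
  factor? (x ∷ u) []      = no λ { ([] , _ , ()) ; (_ ∷ _ , _ , ()) }
  factor? u       (x ∷ w) with prefix? u (x ∷ w) | factor? u w
  ... | yes (s , eq) | _                = yes ([] , s , eq)
  ... | no _         | yes (p , s , eq) = yes (x ∷ p , s , cong (x ∷_) eq)
  ... | no ¬pre      | no ¬fac          = no λ
    { ([]    , s , eq) → ¬pre (s , eq)
    ; (_ ∷ p , s , eq) → ¬fac (p , s , ∷-injectiveʳ eq) }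

  split-last : ∀ {c : A} {l} → c ∈ l → ∃ λ l₁ → ∃ λ l₂ → l ≡ l₁ ++ c ∷ l₂ × c ∉ l₂
  split-last {c} {x ∷ l} c∈ with c ∈? l
  ... | yes c∈l with l₁ , l₂ , refl , c∉l₂ ← split-last c∈l = x ∷ l₁ , l₂ , refl , c∉l₂
  ... | no c∉l = [] , l , cong (_∷ l) (x≡c c∈) , c∉l
    where
    x≡c : c ∈ x ∷ l → x ≡ c
    x≡c (here c≡x)  = sym c≡x
    x≡c (there c∈l) = ⊥-elim (c∉l c∈l)

  oneOf? : ∀ b c s → Dec (s ≡ b ⊎ s ≡ c)
  oneOf? b c s = (s ≟ b) ⊎-dec (s ≟ c)

  OverLetters-or-ThreeDistinct : ∀ {b c l} → b ≢ c → b ∈ l → c ∈ l → OverLetters b c l ⊎ ThreeDistinct l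
  OverLetters-or-ThreeDistinct {b} {c} {l} b≢c b∈l c∈l with all? (oneOf? b c) l
  ... | yes over = inj₁ over
  ... | no ¬over with s , s∈l , s∉bc ← find (¬All⇒Any¬ (oneOf? b c) l ¬over) =
    inj₂ (s , b , c , s∈l , b∈l , c∈l , s∉bc ∘ inj₁ , b≢c , s∉bc ∘ inj₂)

  -- Prefixes that gain no palindrome

  atMostPalFactors-∷ʳ : ∀ {v n} a → AtMostPalFactors v n → AtMostPalFactors (v ∷ʳ a) (suc n)
  atMostPalFactors-∷ʳ {v} {n} a bound L uniq pal = begin
    length L                            ≡⟨ sym (length-filter+filter-∁ old? L) ⟩
    length (filter old? L) + length new ≤⟨ +-mono-≤ oldBound newBound ⟩
    n + 1                               ≡⟨ +-comm n 1 ⟩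
    suc n                               ∎
    where
    open ≤-Reasoning
    old? : ∀ u → Dec (Factor u v)
    old? u = factor? u v
    new : List (List A)
    new = filter (∁? old?) L
    oldBound : length (filter old? L) ≤ n
    oldBound = bound _ (filter⁺ old? uniq) λ u∈ →
      let (u∈L , old) = ∈-filter⁻ old? u∈ ; (u≢[] , palu , _) = pal u∈L in u≢[] , palu , old
    newBound : length new ≤ 1
    newBound = unique-constant-length≤1 (filter⁺ (∁? old?) uniq) λ x∈ y∈ →
      let (x∈L , newx) = ∈-filter⁻ (∁? old?) x∈ ; (y∈L , newy) = ∈-filter⁻ (∁? old?) y∈
      in new-palFactor-unique (pal x∈L) (pal y∈L) newx newy

  atMostPalFactors-++ : ∀ {v n} s → AtMostPalFactors v n → AtMostPalFactors (v ++ s) (n + length s)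
  atMostPalFactors-++ {v} {n} []      bound =
    subst₂ AtMostPalFactors (sym (++-identityʳ v)) (sym (+-identityʳ n)) bound
  atMostPalFactors-++ {v} {n} (x ∷ s) bound =
    subst₂ AtMostPalFactors (++-assoc v [ x ] s) (sym (+-suc n (length s)))
      (atMostPalFactors-++ s (atMostPalFactors-∷ʳ x bound))

  atMostPalFactors-length : ∀ v → AtMostPalFactors v (length v)
  atMostPalFactors-length v = atMostPalFactors-++ v atMostPalFactors-[]

  ¬Rich-without-new-palindrome : ∀ {v a} → (∀ {u} → PalFactor (v ∷ʳ a) u → Factor u v) →
                                 ∀ s → ¬ Rich ((v ∷ʳ a) ++ s)
  ¬Rich-without-new-palindrome {v} {a} old s = atMostPalFactors⇒¬Rich
    (atMostPalFactors-++ s (atMostPalFactors-∷ʳ-old old (atMostPalFactors-length v)))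
    (≤-reflexive (sym (begin
      length ((v ∷ʳ a) ++ s)          ≡⟨ length-++ (v ∷ʳ a) ⟩
      length (v ∷ʳ a) + length s      ≡⟨ cong (_+ length s) (length-++ v) ⟩
      (length v + 1) + length s       ≡⟨ cong (_+ length s) (+-comm (length v) 1) ⟩
      suc (length v + length s)       ∎)))
    where open ≡-Reasoning

  no-new-palindrome : ∀ {p c d} → d ≢ c → c ∈ p → ¬ Factor (c ∷ d ∷ []) (p ∷ʳ d) →
                      ∀ {u} → PalFactor ((p ∷ʳ d) ∷ʳ c) u → Factor u (p ∷ʳ d)
  no-new-palindrome {p} {c} {d} d≢c c∈p ¬cd {u} (u≢[] , pal , fac) with factor? u (p ∷ʳ d)
  ... | yes old = old
  ... | no new with new-factor-suffix fac new | initLast u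
  ... | _ , _   | [] = ⊥-elim (u≢[] refl)
  ... | P , suf | u′ ∷ʳ′ c′
    with P++u′≡pd , refl ← ∷ʳ-injective (P ++ u′) (p ∷ʳ d) (trans (++-assoc P u′ [ c′ ]) suf)
    with initLast u′
  ... | [] = ⊥-elim (new (∈⇒Factor (∈-++⁺ˡ c∈p)))
  ... | u″ ∷ʳ′ d′
    with P++u″≡p , refl ← ∷ʳ-injective (P ++ u″) p (trans (++-assoc P u″ [ d′ ]) P++u′≡pd)
    with ys , u″d≡cdys ← palindrome-∷ʳ-∷ʳ d≢c pal
    = ⊥-elim (¬cd (P , ys , (begin
      P ++ c ∷ d ∷ ys  ≡⟨ cong (P ++_) (sym u″d≡cdys) ⟩
      P ++ u″ ∷ʳ d     ≡⟨ sym (++-assoc P u″ [ d ]) ⟩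
      (P ++ u″) ∷ʳ d   ≡⟨ cong (_∷ʳ d) P++u″≡p ⟩
      p ∷ʳ d           ∎)))
    where open ≡-Reasoning

  ¬Rich-defect : ∀ p {d c} s → d ≢ c → c ∈ p → ¬ Factor (c ∷ d ∷ []) (p ∷ʳ d) →
                 ¬ Rich (p ++ d ∷ c ∷ s)
  ¬Rich-defect p {d} {c} s d≢c c∈p ¬cd = subst (λ v → ¬ Rich v) split
    (¬Rich-without-new-palindrome (no-new-palindrome d≢c c∈p ¬cd) s)
    where
    split : ((p ∷ʳ d) ∷ʳ c) ++ s ≡ p ++ d ∷ c ∷ s
    split = trans (++-assoc (p ∷ʳ d) [ c ] s) (++-assoc p [ d ] (c ∷ s))

  -- Block reversals that are not rich

  record Obstruction (v : List A) : Set where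
    constructor obstruction
    field
      R     : List A
      k     : ℕ
      c g h : A
      M s   : List A
      split : v ≡ R ++ replicate (suc k) c ++ g ∷ M ++ h ∷ c ∷ s
      c∉R   : c ∉ R
      c∉gM  : c ∉ g ∷ M
      h≢c   : h ≢ c
      g≢h   : g ≢ h

  ¬Factor-run : ∀ {c g h : A} {G} → h ≢ c → g ≢ h → c ∉ g ∷ G →
                ∀ k → ¬ Factor (c ∷ h ∷ []) (replicate (suc k) c ++ g ∷ G)
  ¬Factor-run h≢c g≢h avoid zero    ([]    , _ , eq) = g≢h (sym (∷-injectiveˡ (∷-injectiveʳ eq)))
  ¬Factor-run h≢c g≢h avoid (suc k) ([]    , _ , eq) = h≢c (∷-injectiveˡ (∷-injectiveʳ eq))
  ¬Factor-run h≢c g≢h avoid zero    (_ ∷ P , Y , eq) = ¬Factor-∉ avoid (P , Y , ∷-injectiveʳ eq)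
  ¬Factor-run h≢c g≢h avoid (suc k) (_ ∷ P , Y , eq) = ¬Factor-run h≢c g≢h avoid k (P , Y , ∷-injectiveʳ eq)

  Obstruction⇒¬Rich : ∀ {v} → Obstruction v → ¬ Rich v
  Obstruction⇒¬Rich (obstruction R k c g h M s refl c∉R c∉gM h≢c g≢h) =
    subst (λ v → ¬ Rich v) (sym split) (¬Rich-defect p s h≢c (∈-++⁺ʳ R (here refl)) ¬ch)
    where
    run p : List A
    run = replicate (suc k) c
    p = R ++ run ++ g ∷ M
    split : R ++ run ++ g ∷ M ++ h ∷ c ∷ s ≡ p ++ h ∷ c ∷ s
    split = trans (cong (R ++_) (sym (++-assoc run (g ∷ M) (h ∷ c ∷ s))))
                  (sym (++-assoc R (run ++ g ∷ M) (h ∷ c ∷ s)))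
    ¬ch : ¬ Factor (c ∷ h ∷ []) (p ∷ʳ h)
    ¬ch fac = ¬Factor-run h≢c g≢h (∉-∷ʳ c∉gM h≢c) k
      (Factor-skip-∉ R c∉R (subst (Factor (c ∷ h ∷ [])) p∷ʳh fac))
      where
      p∷ʳh : p ∷ʳ h ≡ R ++ run ++ g ∷ M ∷ʳ h
      p∷ʳh = trans (++-assoc R (run ++ g ∷ M) [ h ]) (cong (R ++_) (++-assoc run (g ∷ M) [ h ]))

  Obstruction-++ : ∀ {v} X → Obstruction v → Obstruction (v ++ X)
  Obstruction-++ X (obstruction R k c g h M s refl c∉R c∉gM h≢c g≢h) =
    obstruction R k c g h M (s ++ X) split c∉R c∉gM h≢c g≢h
    where
    open ≡-Reasoning
    run : List A
    run = replicate (suc k) c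
    split : (R ++ run ++ g ∷ M ++ h ∷ c ∷ s) ++ X ≡ R ++ run ++ g ∷ M ++ h ∷ c ∷ s ++ X
    split = begin
      (R ++ run ++ g ∷ M ++ h ∷ c ∷ s) ++ X  ≡⟨ ++-assoc R _ X ⟩
      R ++ (run ++ g ∷ M ++ h ∷ c ∷ s) ++ X  ≡⟨ cong (R ++_) (++-assoc run _ X) ⟩
      R ++ run ++ g ∷ (M ++ h ∷ c ∷ s) ++ X  ≡⟨ cong (λ r → R ++ run ++ g ∷ r) (++-assoc M _ X) ⟩
      R ++ run ++ g ∷ M ++ h ∷ c ∷ s ++ X    ∎

  -- Unlike in InBR, blocks may be empty here.
  ObstructedReversal : List A → Set
  ObstructedReversal w = ∃ λ Bs → concat Bs ≡ w × Obstruction (concat (reverse Bs))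

  ObstructedReversal⇒¬allRich : ∀ {w} → w ≢ [] → ObstructedReversal w → ¬ (∀ v → InBR w v → Rich v)
  ObstructedReversal⇒¬allRich w≢[] (Bs , refl , obs) allRich =
    Obstruction⇒¬Rich obs (allRich _ (InBR-concat Bs w≢[]))

  obstructedReversal-∷ : ∀ t {w} → ObstructedReversal w → ObstructedReversal (t ∷ w)
  obstructedReversal-∷ t (Bs , refl , obs) =
    [ t ] ∷ Bs , refl , subst Obstruction (sym (concat-reverse-∷ [ t ] Bs)) (Obstruction-++ [ t ] obs)

  obstructedReversal-ttgu : ∀ t g u → u ≢ [] → Unique (t ∷ g ∷ u) → ObstructedReversal (t ∷ t ∷ g ∷ u)
  obstructedReversal-ttgu t g u u≢[] uniq with initLast u
  ... | []      = ⊥-elim (u≢[] refl)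
  ... | M ∷ʳ′ h =
    [ t ] ∷ (t ∷ g ∷ M ∷ʳ h) ∷ [] , cong (λ r → t ∷ t ∷ g ∷ r) (++-identityʳ (M ∷ʳ h)) ,
    obstruction [] 0 t g h M [] (cong (λ r → t ∷ g ∷ r) (++-assoc M [ h ] [ t ])) (λ ())
      (t∉ ∘ ∈-++⁺ˡ) (λ h≡t → t∉ (∈-++⁺ʳ (g ∷ M) (here (sym h≡t))))
      (λ g≡h → Unique-head-∉ (tail uniq) (∈-++⁺ʳ M (here g≡h)))
    where
    t∉ : t ∉ g ∷ M ∷ʳ h
    t∉ = Unique-head-∉ uniq

  obstructedReversal-tetgM : ∀ t e g M → Unique (e ∷ t ∷ g ∷ M) → ObstructedReversal (t ∷ e ∷ t ∷ g ∷ M)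
  obstructedReversal-tetgM t e g M uniq =
    [ t ] ∷ [ e ] ∷ (t ∷ g ∷ M) ∷ [] , cong (λ r → t ∷ e ∷ t ∷ g ∷ r) (++-identityʳ M) ,
    obstruction [] 0 t g e M [] refl (λ ()) (Unique-head-∉ (tail uniq))
      (λ e≡t → Unique-head-∉ uniq (here e≡t)) (λ g≡e → Unique-head-∉ uniq (there (here (sym g≡e))))

  obstructedReversal-teut : ∀ t e u u₂ → u ≢ [] → Unique (e ∷ u ++ t ∷ u₂) →
                            ObstructedReversal (t ∷ e ∷ u ++ t ∷ u₂)
  obstructedReversal-teut t e u u₂ u≢[] uniq with initLast u
  ... | []      = ⊥-elim (u≢[] refl)
  ... | M ∷ʳ′ h =
    [ t ∷ e ∷ M ∷ʳ h ++ t ∷ u₂ ] , ++-identityʳ _ ,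
    obstruction [] 0 t e h M u₂ split (λ ()) (t∉ ∘ ∈-++⁺ˡ) (λ h≡t → t∉ (∈-++⁺ʳ (e ∷ M) (here (sym h≡t))))
      (λ e≡h → Unique-head-∉ uniq (∈-++⁺ˡ (∈-++⁺ʳ M (here e≡h))))
    where
    t∉ : t ∉ e ∷ M ∷ʳ h
    t∉ = Unique-∉-prefix (e ∷ M ∷ʳ h) uniq
    split : (t ∷ e ∷ M ∷ʳ h ++ t ∷ u₂) ++ [] ≡ t ∷ e ∷ M ++ h ∷ t ∷ u₂
    split = trans (++-identityʳ _) (cong (λ r → t ∷ e ∷ r) (++-assoc M [ h ] (t ∷ u₂)))

  obstructedReversal-returningHead : ∀ t u₁ u₂ → Unique (u₁ ++ t ∷ u₂) → 3 ≤ length (u₁ ++ t ∷ u₂) →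
                                     ObstructedReversal (t ∷ u₁ ++ t ∷ u₂)
  obstructedReversal-returningHead t []       []              _    (s≤s ())
  obstructedReversal-returningHead t []       (_ ∷ [])        _    (s≤s (s≤s ()))
  obstructedReversal-returningHead t []       (g ∷ u@(_ ∷ _)) uniq _ =
    obstructedReversal-ttgu t g u (λ ()) uniq
  obstructedReversal-returningHead t (_ ∷ []) []              _    (s≤s (s≤s ()))
  obstructedReversal-returningHead t (e ∷ []) (g ∷ M)         uniq _ =
    obstructedReversal-tetgM t e g M uniq
  obstructedReversal-returningHead t (e ∷ u@(_ ∷ _)) u₂       uniq _ =
    obstructedReversal-teut t e u u₂ (λ ()) uniq

  obstructedReversal-cReturns : ∀ {t d c} m r₁ r₂ → t ≢ d → t ≢ c → d ≢ c → c ∉ r₂ →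
                                ObstructedReversal (t ∷ d ∷ replicate m d ++ c ∷ r₁ ++ c ∷ r₂)
  obstructedReversal-cReturns {t} {d} {c} m r₁ r₂ t≢d t≢c d≢c c∉r₂ =
    B ∷ [ c ] ∷ r₂ ∷ [] , concat-eq , obstruction r₂ 0 c t d dᵐ r₁ split c∉r₂ c∉tdᵐ d≢c t≢d
    where
    dᵐ B : List A
    dᵐ = replicate m d
    B = t ∷ d ∷ dᵐ ++ c ∷ r₁
    concat-eq : B ++ c ∷ r₂ ++ [] ≡ t ∷ d ∷ dᵐ ++ c ∷ r₁ ++ c ∷ r₂
    concat-eq = cong (λ r → t ∷ d ∷ r) (trans (++-assoc dᵐ (c ∷ r₁) (c ∷ r₂ ++ []))
                  (cong (λ r → dᵐ ++ c ∷ r₁ ++ c ∷ r) (++-identityʳ r₂)))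
    split : r₂ ++ c ∷ B ++ [] ≡ r₂ ++ c ∷ t ∷ dᵐ ++ d ∷ c ∷ r₁
    split = cong (λ r → r₂ ++ c ∷ t ∷ r) (trans (++-identityʳ _) (sym (replicate-++-∷ m d (c ∷ r₁))))
    c∉tdᵐ : c ∉ t ∷ dᵐ
    c∉tdᵐ (here c≡t)   = t≢c (sym c≡t)
    c∉tdᵐ (there c∈dᵐ) = d≢c (sym (All.lookup (replicate⁺ {P = _≡ d} m refl) c∈dᵐ))

  obstructedReversal-dRun : ∀ {t d c} m r → t ≢ d → t ≢ c → d ≢ c → All (_≡ d) r →
                            ¬ Unique (d ∷ replicate m d ++ c ∷ r) →
                            ObstructedReversal (t ∷ d ∷ replicate m d ++ c ∷ r)
  obstructedReversal-dRun {t} {d} {c} m (d ∷ r) t≢d t≢c d≢c (refl ∷ r≡d) _ =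
    (t ∷ d ∷ replicate m d) ∷ [ c ] ∷ (d ∷ r) ∷ [] ,
    cong (λ x → t ∷ d ∷ replicate m d ++ c ∷ d ∷ x) (++-identityʳ r) ,
    obstruction [] (length r) d c t [] (replicate m d)
      (cong₂ (λ x y → d ∷ x ++ c ∷ t ∷ d ∷ y) (All-≡⇒≡replicate r≡d) (++-identityʳ _))
      (λ ()) (λ { (here d≡c) → d≢c d≡c }) t≢d (λ c≡t → t≢c (sym c≡t))
  obstructedReversal-dRun {t} {d} {c} (suc m) [] t≢d t≢c d≢c [] _ =
    (t ∷ d ∷ replicate m d) ∷ (d ∷ c ∷ []) ∷ [] ,
    cong (λ x → t ∷ d ∷ x) (replicate-++-∷ m d [ c ]) ,
    obstruction [] 0 d c t [] (replicate m d) (cong (λ x → d ∷ c ∷ t ∷ d ∷ x) (++-identityʳ _))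
      (λ ()) (λ { (here d≡c) → d≢c d≡c }) t≢d (λ c≡t → t≢c (sym c≡t))
  obstructedReversal-dRun zero [] _ _ d≢c [] ¬uniq = ⊥-elim (¬uniq ((d≢c ∷ []) ∷ [] ∷ []))

  obstructedReversal-binary : ∀ {t d c} u → t ≢ d → t ≢ c → d ≢ c → c ∈ u → OverLetters d c u →
                              ¬ Unique (d ∷ u) → ObstructedReversal (t ∷ d ∷ u)
  obstructedReversal-binary {d = d} {c} u t≢d t≢c d≢c c∈u over ¬uniq
    with m , r , refl ← split-first over c∈u
    with c ∈? r
  ... | yes c∈r with r₁ , r₂ , refl , c∉r₂ ← split-last c∈r =
    obstructedReversal-cReturns m r₁ r₂ t≢d t≢c d≢c c∉r₂
  ... | no c∉r =
    obstructedReversal-dRun m r t≢d t≢c d≢c (OverLetters-∉ (All.tail (++⁻ʳ (replicate m d) over)) c∉r) ¬uniq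

  obstructedReversal-binaryTail : ∀ {t b c} w → t ∉ w → b ≢ c → b ∈ w → c ∈ w → OverLetters b c w →
                                  ¬ Unique w → ObstructedReversal (t ∷ w)
  obstructedReversal-binaryTail (d ∷ u) t∉w b≢c b∈w c∈w (inj₁ refl ∷ over) ¬uniq =
    obstructedReversal-binary u (t∉w ∘ here) (λ t≡c → t∉w (subst (_∈ _) (sym t≡c) c∈w)) b≢c
      (∈-∷⁻ c∈w (b≢c ∘ sym)) over ¬uniq
  obstructedReversal-binaryTail (d ∷ u) t∉w b≢c b∈w c∈w (inj₂ refl ∷ over) ¬uniq =
    obstructedReversal-binary u (t∉w ∘ here) (λ t≡b → t∉w (subst (_∈ _) (sym t≡b) b∈w)) (b≢c ∘ sym)
      (∈-∷⁻ b∈w b≢c) (All.map swap over) ¬uniq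

  obstructedReversal : ∀ w → ¬ Unique w → ThreeDistinct w → ObstructedReversal w
  obstructedReversal []      _     (_ , _ , _ , () , _)
  obstructedReversal (t ∷ w) ¬uniq three with unique? w | t ∈? w
  ... | yes uniq | yes t∈w with u₁ , u₂ , refl ← ∈-∃++ t∈w =
    obstructedReversal-returningHead t u₁ u₂ uniq (ThreeDistinct⇒3≤length (ThreeDistinct-∷⁻ t∈w three))
  ... | yes uniq | no t∉w  = ⊥-elim (¬uniq (¬Any⇒All¬ w t∉w ∷ uniq))
  ... | no ¬uniq′ | yes t∈w =
    obstructedReversal-∷ t (obstructedReversal w ¬uniq′ (ThreeDistinct-∷⁻ t∈w three))
  ... | no ¬uniq′ | no t∉w
    with b , c , b≢c , b∈w , c∈w ← ThreeDistinct-∷⇒two three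
    with OverLetters-or-ThreeDistinct b≢c b∈w c∈w
  ... | inj₁ over   = obstructedReversal-binaryTail w t∉w b≢c b∈w c∈w over ¬uniq′
  ... | inj₂ three′ = obstructedReversal-∷ t (obstructedReversal w ¬uniq′ three′)

  forward : ∀ w → w ≢ [] → ¬ NumLetters w 2 → (∀ v → InBR w v → Rich v) →
            Unique w ⊎ ∃ λ a → w ≡ replicate (length w) a
  forward []        w≢[] _       _       = ⊥-elim (w≢[] refl)
  forward w@(a ∷ _) w≢[] ¬binary allRich with unique? w | all? (_≟ a) w
  ... | yes uniq  | _         = inj₁ uniq
  ... | no _      | yes all-a = inj₂ (a , All-≡⇒≡replicate all-a)
  ... | no ¬uniq  | no ¬all-a
    with b , b∈w , b≢a ← find (¬All⇒Any¬ (_≟ a) w ¬all-a)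
    with OverLetters-or-ThreeDistinct (b≢a ∘ sym) (here refl) b∈w
  ... | inj₁ over  = ⊥-elim (¬binary (OverLetters⇒NumLetters2 (b≢a ∘ sym) (here refl) b∈w over))
  ... | inj₂ three = ⊥-elim (ObstructedReversal⇒¬allRich w≢[] (obstructedReversal w ¬uniq three) allRich)

theorem3p7 : {A : Set} → DecidableEquality A → (w : List A) → NonEmpty w →
    ¬ NumLetters w 2 →
    ((∀ v → InBR w v → Rich v) ⇔ (Unique w ⊎ Σ A (λ a → w ≡ replicate (length w) a)))
theorem3p7 _≟_ w w≢[] ¬binary = mk⇔ (forward _≟_ w w≢[] ¬binary) backward
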